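{- Ben has a winning strategy in the erase-repetition game over an alphabet of $3$ letters: he has a strategy such that, whatever Ann plays, the length of the shared word stays bounded.
   Context: A square is a word $uu$ with $u$ non-empty (any period $|u|\ge1$). The erase-repetition game over an alphabet $\mathcal{A}$ is played by Ann and Ben, who, starting from the empty word, alternately append one letter of $\mathcal{A}$ to the end of a shared word, Ann playing first. As soon as a square $uu$ occurs (as a suffix of the current word), the second half $u$ of that square is erased. Ann's goal is to build arbitrarily long words; Ben wins if he can keep the length of the word bounded. -}

module Defs where

open import Data.Nat using (ℕ; zero; suc; _+_; _∸_; _≤_; _*_)
open import Data.Nat.Properties using (_≤?_)
open import Data.Bool using (Bool; true; false; if_then_else_; not; _∧_)
open import Data.Fin using (Fin)
open import Data.Fin.Properties using (_≟_)
open import Data.List using (List; []; _∷_; _++_; [_]; length; take; drop; foldl)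
open import Data.List.Properties using (≡-dec)
open import Relation.Nullary.Decidable using (⌊_⌋)

Letter : Set
Letter = Fin 3

Word : Set
Word = List Letter

hasSquareSuffixOfPeriod : ℕ → Word → Bool
hasSquareSuffixOfPeriod zero    w = false
hasSquareSuffixOfPeriod (suc q) w =
  let p = suc q ; n = length w in
  ⌊ (p + p) ≤? n ⌋ ∧ ⌊ ≡-dec _≟_ (take p (drop (n ∸ (p + p)) w)) (drop (n ∸ p) w) ⌋

eraseFrom : ℕ → ℕ → Word → Word
eraseFrom k zero       w = w
eraseFrom k (suc fuel) w =
  if hasSquareSuffixOfPeriod k w
  then take (length w ∸ k) w
  else eraseFrom (suc k) fuel w

-- If the word has a square suffix uu (u non-empty), erase its second half u.
-- (Periods 1 .. length w are searched; a square suffix has period ≤ length w / 2.)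
eraseSquare : Word → Word
eraseSquare w = eraseFrom 1 (length w) w

move : Word → Letter → Word
move w a = eraseSquare (w ++ [ a ])

-- A strategy maps the history of all letters played so far (in order) to a letter.
Strategy : Set
Strategy = List Letter → Letter

-- History (sequence of letters played) after n single moves; Ann plays the
-- moves number 0, 2, 4, ... (she plays first), Ben the moves 1, 3, 5, ...
annsTurn : ℕ → Bool
annsTurn zero    = true
annsTurn (suc n) = not (annsTurn n)

history : Strategy → Strategy → ℕ → List Letter
history ann ben zero    = []
history ann ben (suc n) =
  let h = history ann ben n in
  h ++ [ (if annsTurn n then ann h else ben h) ]

wordOf : List Letter → Word
wordOf = foldl move []

sharedWord : Strategy → Strategy → ℕ → Word
sharedWord ann ben n = wordOf (history ann ben n)

{-# OPTIONS --safe #-}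
-- Ben keeps the shared word inside a finite set of square-free words of length at most 5.
-- The set splits into positions with Ann to move and positions with Ben to move; every
-- letter Ann appends leads from the first kind to the second, and Ben has a reply leading
-- back.  Both closure properties and the length bound are finite checks, decided by
-- evaluation.
module Submission where

open import Defs
open import Data.Nat using (ℕ; zero; suc; _≤_)
open import Data.Nat.Properties using (_≤?_)
open import Data.Bool using (true; false; if_then_else_)
open import Data.Fin using (zero; suc)
open import Data.Fin.Properties using (_≟_) renaming (all? to allLetters?)
open import Data.List using (List; []; _∷_; length)
open import Data.List.Properties using (≡-dec; foldl-∷ʳ)
open import Data.List.Relation.Unary.All as All using (All; all?)
open import Data.List.Membership.Propositional using (_∈_)
open import Data.List.Membership.DecPropositional {A = Word} (≡-dec _≟_) using (_∈?_)
open import Data.Product using (Σ; _,_)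
open import Relation.Nullary.Decidable using (from-yes)
open import Relation.Binary.PropositionalEquality using (_≡_)

positional : (Word → Letter) → Strategy
positional σ h = σ (wordOf h)

sharedWord-suc : ∀ ann ben n →
  sharedWord ann ben (suc n) ≡
    move (sharedWord ann ben n)
         (if annsTurn n then ann (history ann ben n) else ben (history ann ben n))
sharedWord-suc ann ben n = foldl-∷ʳ move [] _ (history ann ben n)

module _ {A B : Word → Set} (σ : Word → Letter)
         (A-[] : A [])
         (A⇒B : ∀ {w} → A w → ∀ ℓ → B (move w ℓ))
         (B⇒A : ∀ {w} → B w → A (move w (σ w))) where

  sharedWord-turnInvariant : (ann : Strategy) (n : ℕ) →
    (if annsTurn n then A else B) (sharedWord ann (positional σ) n)
  sharedWord-turnInvariant ann zero = A-[]
  sharedWord-turnInvariant ann (suc n)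
    with annsTurn n | sharedWord-turnInvariant ann n | sharedWord-suc ann (positional σ) n
  ... | true  | inA | eq rewrite eq = A⇒B inA _
  ... | false | inB | eq rewrite eq = B⇒A inB

  sharedWord-bounded : ∀ {N} → (∀ {w} → A w → length w ≤ N) → (∀ {w} → B w → length w ≤ N) →
    (ann : Strategy) (n : ℕ) → length (sharedWord ann (positional σ) n) ≤ N
  sharedWord-bounded boundA boundB ann n with annsTurn n | sharedWord-turnInvariant ann n
  ... | true  | inA = boundA inA
  ... | false | inB = boundB inB

pattern a = zero
pattern b = suc zero
pattern c = suc (suc zero)

annPositions : List Word
annPositions =
  []
  ∷ (a ∷ [])
  ∷ (a ∷ b ∷ [])
  ∷ (a ∷ b ∷ c ∷ [])
  ∷ (a ∷ b ∷ c ∷ a ∷ [])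
  ∷ (a ∷ c ∷ b ∷ [])
  ∷ (a ∷ c ∷ b ∷ a ∷ [])
  ∷ (b ∷ a ∷ [])
  ∷ (b ∷ a ∷ c ∷ [])
  ∷ (b ∷ a ∷ c ∷ b ∷ [])
  ∷ (c ∷ a ∷ [])
  ∷ (c ∷ a ∷ b ∷ [])
  ∷ (c ∷ a ∷ b ∷ c ∷ [])
  ∷ []

benPositions : List Word
benPositions =
  (a ∷ [])
  ∷ (a ∷ b ∷ [])
  ∷ (a ∷ b ∷ a ∷ [])
  ∷ (a ∷ b ∷ c ∷ [])
  ∷ (a ∷ b ∷ c ∷ a ∷ [])
  ∷ (a ∷ b ∷ c ∷ a ∷ b ∷ [])
  ∷ (a ∷ b ∷ c ∷ a ∷ c ∷ [])
  ∷ (a ∷ b ∷ c ∷ b ∷ [])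
  ∷ (a ∷ c ∷ [])
  ∷ (a ∷ c ∷ b ∷ [])
  ∷ (a ∷ c ∷ b ∷ a ∷ [])
  ∷ (a ∷ c ∷ b ∷ a ∷ b ∷ [])
  ∷ (a ∷ c ∷ b ∷ a ∷ c ∷ [])
  ∷ (a ∷ c ∷ b ∷ c ∷ [])
  ∷ (b ∷ [])
  ∷ (b ∷ a ∷ [])
  ∷ (b ∷ a ∷ b ∷ [])
  ∷ (b ∷ a ∷ c ∷ [])
  ∷ (b ∷ a ∷ c ∷ a ∷ [])
  ∷ (b ∷ a ∷ c ∷ b ∷ [])
  ∷ (b ∷ a ∷ c ∷ b ∷ a ∷ [])
  ∷ (b ∷ a ∷ c ∷ b ∷ c ∷ [])
  ∷ (c ∷ [])
  ∷ (c ∷ a ∷ [])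
  ∷ (c ∷ a ∷ b ∷ [])
  ∷ (c ∷ a ∷ b ∷ a ∷ [])
  ∷ (c ∷ a ∷ b ∷ c ∷ [])
  ∷ (c ∷ a ∷ b ∷ c ∷ a ∷ [])
  ∷ (c ∷ a ∷ b ∷ c ∷ b ∷ [])
  ∷ (c ∷ a ∷ c ∷ [])
  ∷ []

benReply : Word → Letter
benReply (a ∷ []) = a
benReply (a ∷ b ∷ []) = b
benReply (a ∷ b ∷ a ∷ []) = b
benReply (a ∷ b ∷ c ∷ []) = a
benReply (a ∷ b ∷ c ∷ a ∷ []) = a
benReply (a ∷ b ∷ c ∷ a ∷ b ∷ []) = c
benReply (a ∷ b ∷ c ∷ a ∷ c ∷ []) = a
benReply (a ∷ b ∷ c ∷ b ∷ []) = c
benReply (a ∷ c ∷ []) = b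
benReply (a ∷ c ∷ b ∷ []) = a
benReply (a ∷ c ∷ b ∷ a ∷ []) = a
benReply (a ∷ c ∷ b ∷ a ∷ b ∷ []) = a
benReply (a ∷ c ∷ b ∷ a ∷ c ∷ []) = b
benReply (a ∷ c ∷ b ∷ c ∷ []) = b
benReply (b ∷ []) = a
benReply (b ∷ a ∷ []) = a
benReply (b ∷ a ∷ b ∷ []) = a
benReply (b ∷ a ∷ c ∷ []) = b
benReply (b ∷ a ∷ c ∷ a ∷ []) = c
benReply (b ∷ a ∷ c ∷ b ∷ []) = b
benReply (b ∷ a ∷ c ∷ b ∷ a ∷ []) = c
benReply (b ∷ a ∷ c ∷ b ∷ c ∷ []) = b
benReply (c ∷ []) = a
benReply (c ∷ a ∷ []) = a
benReply (c ∷ a ∷ b ∷ []) = b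
benReply (c ∷ a ∷ b ∷ a ∷ []) = b
benReply (c ∷ a ∷ b ∷ c ∷ []) = c
benReply (c ∷ a ∷ b ∷ c ∷ a ∷ []) = b
benReply (c ∷ a ∷ b ∷ c ∷ b ∷ []) = c
benReply (c ∷ a ∷ c ∷ []) = a
-- Only reached outside benPositions, where the reply is irrelevant.
benReply _ = a

annPositions-closed : All (λ w → ∀ ℓ → move w ℓ ∈ benPositions) annPositions
annPositions-closed =
  from-yes (all? (λ w → allLetters? (λ ℓ → move w ℓ ∈? benPositions)) annPositions)

benPositions-closed : All (λ w → move w (benReply w) ∈ annPositions) benPositions
benPositions-closed = from-yes (all? (λ w → move w (benReply w) ∈? annPositions) benPositions)

annPositions-short : All (λ w → length w ≤ 5) annPositions
annPositions-short = from-yes (all? (λ w → length w ≤? 5) annPositions)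

benPositions-short : All (λ w → length w ≤ 5) benPositions
benPositions-short = from-yes (all? (λ w → length w ≤? 5) benPositions)

lemma6 : Σ Strategy (λ ben → Σ ℕ (λ N → (ann : Strategy) (n : ℕ) → length (sharedWord ann ben n) ≤ N))
lemma6 = positional benReply , 5 ,
  sharedWord-bounded {A = _∈ annPositions} {B = _∈ benPositions} benReply
    (from-yes ([] ∈? annPositions))
    (All.lookup annPositions-closed) (All.lookup benPositions-closed)
    (All.lookup annPositions-short) (All.lookup benPositions-short)
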